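{- Let $G_1=(V_1,E_1)$ and $G_2=(V_2,E_2)$ be finite graphs, and let $x_1,\ldots,x_k\in V_1$ and $y_1,\ldots,y_k\in V_2$ be distinct distinguished vertices. Let $G_1\# G_2$ be their connected sum along these vertices. Then \[ M(G_1\# G_2)=\sum_{(\epsilon_1,\ldots,\epsilon_k)\in\{y,n\}^k} G_1(\epsilon_1,\ldots,\epsilon_k)\, G_2(\bar\epsilon_1,\ldots,\bar\epsilon_k). \]
   Context: Graphs are finite and may have multiple edges. A perfect matching of a graph is a set of edges such that every vertex is incident to exactly one edge of the set; $M(G)$ denotes the number of perfect matchings of $G$ (the graph with no vertices has exactly one perfect matching, the empty one). For a graph $G$ with distinguished vertices $v_1,\ldots,v_k$ and $(\epsilon_1,\ldots,\epsilon_k)\in\{y,n\}^k$ (here $y,n$ are two formal symbols), $G(\epsilon_1,\ldots,\epsilon_k)$ is the number of perfect matchings of the graph obtained from $G$ by deleting each vertex $v_i$ with $\epsilon_i=y$ (together with its incident edges) and keeping each $v_i$ with $\epsilon_i=n$. The involution $\epsilon\mapsto\bar\epsilon$ exchanges $y$ and $n$. The connected sum $G_1\# G_2$ is the graph with vertex set $(V_1\sqcup V_2)/(x_i\sim y_i \text{ for all } 1\le i\le k)$ and edge set $E_1\sqcup E_2$ (each edge keeping its endpoints, read in the quotient). -}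

module Defs where

open import Data.Nat using (ℕ; zero; suc; _+_; _*_)
open import Data.Nat.Properties using () renaming (_≟_ to _≟ℕ_)
open import Data.Bool using (Bool; true; false; not; _∧_; _∨_; if_then_else_)
open import Data.Fin using (Fin; zero; suc; _↑ˡ_; _↑ʳ_)
open import Data.Fin.Properties using (_≟_; all?)
open import Data.Maybe using (Maybe; just; nothing; is-just)
import Data.Maybe as Maybe
open import Data.List using (List; []; _∷_; [_]; _++_; map; length; filter; mapMaybe; sum)
open import Data.Vec using (Vec; []; _∷_; lookup)
import Data.Vec as Vec
open import Data.Product using (_×_; _,_)
open import Data.Sum using (inj₁; inj₂)
open import Relation.Binary.PropositionalEquality using (_≡_)
open import Relation.Nullary using (Dec; yes; no; ⌊_⌋)

-- A finite multigraph: vertices Fin nV, edges a list (multiset) of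
-- unordered pairs of endpoints (the order inside a pair is irrelevant).
record Graph : Set where
  constructor graph
  field
    nV    : ℕ
    edges : List (Fin nV × Fin nV)
open Graph public

Selection : Graph → Set
Selection G = Vec Bool (length (edges G))

degreeIn : {n : ℕ} (es : List (Fin n × Fin n)) → Vec Bool (length es) → Fin n → ℕ
degreeIn [] [] v = 0
degreeIn ((a , b) ∷ es) (s ∷ ss) v =
  (if s ∧ (⌊ a ≟ v ⌋ ∨ ⌊ b ≟ v ⌋) then 1 else 0) + degreeIn es ss v

IsPerfectMatching : (G : Graph) → Selection G → Set
IsPerfectMatching G s = ∀ v → degreeIn (edges G) s v ≡ 1

isPerfectMatching? : (G : Graph) (s : Selection G) → Dec (IsPerfectMatching G s)
isPerfectMatching? G s = all? (λ v → degreeIn (edges G) s v ≟ℕ 1)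

allVecs : (m : ℕ) → List (Vec Bool m)
allVecs zero = [ [] ]
allVecs (suc m) = map (true ∷_) (allVecs m) ++ map (false ∷_) (allVecs m)

M : Graph → ℕ
M G = length (filter (isPerfectMatching? G) (allVecs (length (edges G))))

-- Vertex deletion: D v = true means v is deleted.
countFalse : {n : ℕ} → Vec Bool n → ℕ
countFalse [] = 0
countFalse (true ∷ D) = countFalse D
countFalse (false ∷ D) = suc (countFalse D)

reindex : {n : ℕ} (D : Vec Bool n) → Fin n → Maybe (Fin (countFalse D))
reindex (true ∷ D) zero = nothing
reindex (false ∷ D) zero = just zero
reindex (true ∷ D) (suc i) = reindex D i
reindex (false ∷ D) (suc i) = Maybe.map suc (reindex D i)

deleteVertices : (G : Graph) → Vec Bool (nV G) → Graph
deleteVertices G D = graph (countFalse D) (mapMaybe f (edges G))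
  where
  f : Fin (nV G) × Fin (nV G) → Maybe (Fin (countFalse D) × Fin (countFalse D))
  f (a , b) with reindex D a | reindex D b
  ... | just a' | just b' = just (a' , b')
  ... | _ | _ = nothing

preimage : {k n : ℕ} → (Fin k → Fin n) → Fin n → Maybe (Fin k)
preimage {zero} x v = nothing
preimage {suc k} x v with x zero ≟ v
... | yes _ = just zero
... | no _ = Maybe.map suc (preimage (λ i → x (suc i)) v)

-- G(ε₁,…,εₖ) for distinguished vertices x : Fin k → Fin (nV G);
-- ε i = true means symbol y (delete x i), false means n (keep x i).
evalDel : (G : Graph) {k : ℕ} (x : Fin k → Fin (nV G)) → Vec Bool k → ℕ
evalDel G x ε = M (deleteVertices G (Vec.tabulate D))
  where
  D : Fin (nV G) → Bool
  D v with preimage x v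
  ... | just i = lookup ε i
  ... | nothing = false

-- Built as: disjoint union on Fin (n₁ + n₂), where every G₂-edge endpoint
-- y i is redirected to x i; then the (now isolated) copies of the y i are
-- deleted.  This is exactly (V₁ ⊔ V₂)/(xᵢ ∼ yᵢ) with edge set E₁ ⊔ E₂.
connectedSum : (G₁ G₂ : Graph) {k : ℕ} → (Fin k → Fin (nV G₁)) → (Fin k → Fin (nV G₂)) → Graph
connectedSum G₁ G₂ {k} x y = deleteVertices U (Vec.tabulate D)
  where
  n₁ = nV G₁
  n₂ = nV G₂
  inl : Fin n₁ → Fin (n₁ + n₂)
  inl v = v ↑ˡ n₂
  inr : Fin n₂ → Fin (n₁ + n₂)
  inr v with preimage y v
  ... | just i = inl (x i)
  ... | nothing = n₁ ↑ʳ v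
  U : Graph
  U = graph (n₁ + n₂)
        (map (λ { (a , b) → inl a , inl b }) (edges G₁) ++
         map (λ { (a , b) → inr a , inr b }) (edges G₂))
  D : Fin (n₁ + n₂) → Bool
  D w with Data.Fin.splitAt n₁ w
  ... | inj₁ _ = false
  ... | inj₂ v = is-just (preimage y v)

{-# OPTIONS --safe #-}
module Submission where

open import Defs
open import Data.Bool using (Bool; true; false; not; _∨_; if_then_else_)
open import Data.Empty using (⊥-elim)
open import Data.Fin using (Fin; zero; suc; _↑ˡ_; _↑ʳ_; splitAt)
open import Data.Fin.Properties
  using (_≟_; all?; suc-injective; ↑ˡ-injective; ↑ʳ-injective; splitAt-↑ˡ; splitAt-↑ʳ; splitAt⁻¹-↑ˡ; splitAt⁻¹-↑ʳ)
open import Data.List using (List; []; _∷_; _++_; map; length; filter; mapMaybe)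
open import Data.List.Properties using (map-++; map-∘)
open import Data.Maybe using (Maybe; just; nothing; is-just)
open import Data.Nat using (ℕ; zero; suc; _+_; _*_; _≡ᵇ_)
open import Data.Nat.ListAction using (sum)
open import Data.Nat.ListAction.Properties using (sum-++)
open import Data.Nat.Properties
  using (+-assoc; +-identityʳ; m+n≡0⇒m≡0; m+n≡0⇒n≡0; *-distribˡ-+; *-distribʳ-+; +-commutativeSemigroup) renaming (_≟_ to _≟ℕ_)
open import Algebra.Properties.CommutativeSemigroup +-commutativeSemigroup using (interchange)
open import Data.Product using (Σ-syntax; _×_; _,_; proj₁; proj₂)
import Data.Product as Product
open import Data.Sum using (inj₁; inj₂)
open import Data.Vec using (Vec; []; _∷_; lookup; tabulate)
import Data.Vec as Vec
open import Data.Vec.Properties using (∷-injectiveʳ; lookup∘tabulate; tabulate∘lookup; tabulate-cong; lookup-map)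
open import Function using (_∘_)
open import Function.Bundles using (mk⇔)
open import Function.Definitions using (Injective)
open import Relation.Nullary using (Dec; yes; no; ¬_; ⌊_⌋)
open import Relation.Nullary.Decidable using (_×-dec_; isYes≗does; dec-false; does-⇔)
open import Relation.Unary using (Pred; Decidable)
open import Relation.Binary.PropositionalEquality
  using (_≡_; _≢_; _≗_; refl; sym; trans; cong; cong₂; subst; module ≡-Reasoning)

open ≡-Reasoning

-- A selection of edges of G₁ # G₂ is a pair of selections from E₁ and E₂.  It is a perfect
-- matching iff every unglued vertex is covered once from its own side and every glued
-- vertex xᵢ = yᵢ is covered once in total, i.e. from exactly one side; recording that side
-- gives the unique ε with εᵢ = y iff xᵢ is covered from G₂.  Perfect matchings of G minus a
-- vertex set D are in turn the edge selections of G covering D zero times and every other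
-- vertex once.  So each perfect matching of G₁ # G₂ is counted exactly once on the right,
-- in the term G₁(ε) G₂(ε̄), and the identity follows by exchanging finite sums.

χ : ∀ {p} {P : Set p} → Dec P → ℕ
χ (yes _) = 1
χ (no _)  = 0

module _ {p q} {P : Set p} {Q : Set q} where

  χ-⇔ : (P? : Dec P) (Q? : Dec Q) → (P → Q) → (Q → P) → χ P? ≡ χ Q?
  χ-⇔ (yes _)  (yes _)  _ _ = refl
  χ-⇔ (yes p)  (no ¬q)  f _ = ⊥-elim (¬q (f p))
  χ-⇔ (no ¬p)  (yes q)  _ g = ⊥-elim (¬p (g q))
  χ-⇔ (no _)   (no _)   _ _ = refl

  χ-× : (P? : Dec P) (Q? : Dec Q) → χ (P? ×-dec Q?) ≡ χ P? * χ Q?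
  χ-× (yes _) (yes _) = refl
  χ-× (yes _) (no _)  = refl
  χ-× (no _)  (yes _) = refl
  χ-× (no _)  (no _)  = refl

χ-¬ : ∀ {p} {P : Set p} (P? : Dec P) → ¬ P → χ P? ≡ 0
χ-¬ (yes p) ¬p = ⊥-elim (¬p p)
χ-¬ (no _)  _  = refl

length-filter≡sum-χ : ∀ {a p} {A : Set a} {P : Pred A p} (P? : Decidable P) (xs : List A) →
                      length (filter P? xs) ≡ sum (map (χ ∘ P?) xs)
length-filter≡sum-χ P? []       = refl
length-filter≡sum-χ P? (x ∷ xs) with P? x
... | yes _ = cong suc (length-filter≡sum-χ P? xs)
... | no _  = length-filter≡sum-χ P? xs

-- Sums over all edge selections

∑ : (m : ℕ) → (Vec Bool m → ℕ) → ℕ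
∑ zero    F = F []
∑ (suc m) F = ∑ m (F ∘ (true ∷_)) + ∑ m (F ∘ (false ∷_))

∑≡sum-allVecs : ∀ m (F : Vec Bool m → ℕ) → ∑ m F ≡ sum (map F (allVecs m))
∑≡sum-allVecs zero    F = sym (+-identityʳ (F []))
∑≡sum-allVecs (suc m) F = begin
  ∑ m (F ∘ (true ∷_)) + ∑ m (F ∘ (false ∷_))
    ≡⟨ cong₂ _+_ (∑≡sum-allVecs m _) (∑≡sum-allVecs m _) ⟩
  sum (map (F ∘ (true ∷_)) vs) + sum (map (F ∘ (false ∷_)) vs)
    ≡⟨ cong₂ _+_ (cong sum (map-∘ vs)) (cong sum (map-∘ vs)) ⟩
  sum (map F (map (true ∷_) vs)) + sum (map F (map (false ∷_) vs))
    ≡⟨ sum-++ (map F (map (true ∷_) vs)) _ ⟨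
  sum (map F (map (true ∷_) vs) ++ map F (map (false ∷_) vs))
    ≡⟨ cong sum (map-++ F (map (true ∷_) vs) _) ⟨
  sum (map F (allVecs (suc m))) ∎
  where vs = allVecs m

∑-cong : ∀ {m} {F G : Vec Bool m → ℕ} → F ≗ G → ∑ m F ≡ ∑ m G
∑-cong {zero}  F≗G = F≗G []
∑-cong {suc m} F≗G = cong₂ _+_ (∑-cong (F≗G ∘ (true ∷_))) (∑-cong (F≗G ∘ (false ∷_)))

∑-zero : ∀ {m} {F : Vec Bool m → ℕ} → (∀ s → F s ≡ 0) → ∑ m F ≡ 0
∑-zero {zero}  F≡0 = F≡0 []
∑-zero {suc m} F≡0 = cong₂ _+_ (∑-zero (F≡0 ∘ (true ∷_))) (∑-zero (F≡0 ∘ (false ∷_)))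

∑-single : ∀ {m} {F : Vec Bool m → ℕ} (s₀ : Vec Bool m) → (∀ s → s ≢ s₀ → F s ≡ 0) → ∑ m F ≡ F s₀
∑-single {zero}  []           _   = refl
∑-single {suc m} (true ∷ s₀) F≡0 =
  trans (cong₂ _+_ (∑-single s₀ (λ s s≢s₀ → F≡0 (true ∷ s) (s≢s₀ ∘ ∷-injectiveʳ)))
                   (∑-zero (λ s → F≡0 (false ∷ s) λ ())))
        (+-identityʳ _)
∑-single {suc m} (false ∷ s₀) F≡0 =
  cong₂ _+_ (∑-zero (λ s → F≡0 (true ∷ s) λ ()))
            (∑-single s₀ (λ s s≢s₀ → F≡0 (false ∷ s) (s≢s₀ ∘ ∷-injectiveʳ)))

∑-+ : ∀ {m} (F G : Vec Bool m → ℕ) → ∑ m (λ s → F s + G s) ≡ ∑ m F + ∑ m G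
∑-+ {zero}  F G = refl
∑-+ {suc m} F G = begin
  ∑ m _ + ∑ m _
    ≡⟨ cong₂ _+_ (∑-+ (F ∘ (true ∷_)) (G ∘ (true ∷_))) (∑-+ (F ∘ (false ∷_)) (G ∘ (false ∷_))) ⟩
  (∑ m (F ∘ (true ∷_)) + ∑ m (G ∘ (true ∷_))) + (∑ m (F ∘ (false ∷_)) + ∑ m (G ∘ (false ∷_)))
    ≡⟨ interchange (∑ m (F ∘ (true ∷_))) _ _ _ ⟩
  (∑ m (F ∘ (true ∷_)) + ∑ m (F ∘ (false ∷_))) + (∑ m (G ∘ (true ∷_)) + ∑ m (G ∘ (false ∷_))) ∎

∑-*ˡ : ∀ {m} c (F : Vec Bool m → ℕ) → ∑ m (λ s → c * F s) ≡ c * ∑ m F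
∑-*ˡ {zero}  c F = refl
∑-*ˡ {suc m} c F = trans (cong₂ _+_ (∑-*ˡ c (F ∘ (true ∷_))) (∑-*ˡ c (F ∘ (false ∷_))))
                         (sym (*-distribˡ-+ c _ _))

∑-*ʳ : ∀ {m} c (F : Vec Bool m → ℕ) → ∑ m (λ s → F s * c) ≡ ∑ m F * c
∑-*ʳ {zero}  c F = refl
∑-*ʳ {suc m} c F = trans (cong₂ _+_ (∑-*ʳ c (F ∘ (true ∷_))) (∑-*ʳ c (F ∘ (false ∷_))))
                         (sym (*-distribʳ-+ c (∑ m (F ∘ (true ∷_))) _))

∑-comm : ∀ {m n} (F : Vec Bool m → Vec Bool n → ℕ) →
         ∑ m (λ s → ∑ n (F s)) ≡ ∑ n (λ t → ∑ m (λ s → F s t))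
∑-comm {zero}  F = refl
∑-comm {suc m} F = trans (cong₂ _+_ (∑-comm (F ∘ (true ∷_))) (∑-comm (F ∘ (false ∷_))))
                           (sym (∑-+ (λ t → ∑ m (λ s → F (true ∷ s) t)) (λ t → ∑ m (λ s → F (false ∷ s) t))))

∑*∑ : ∀ {m n} (F : Vec Bool m → ℕ) (G : Vec Bool n → ℕ) →
      ∑ m F * ∑ n G ≡ ∑ m (λ s → ∑ n (λ t → F s * G t))
∑*∑ F G = trans (sym (∑-*ʳ _ F)) (∑-cong (λ s → sym (∑-*ˡ (F s) G)))

joinSelections : ∀ {a} {A : Set a} (L₁ : List A) {L₂ : List A} →
                 Vec Bool (length L₁) → Vec Bool (length L₂) → Vec Bool (length (L₁ ++ L₂))
joinSelections []       []       s₂ = s₂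
joinSelections (_ ∷ L₁) (b ∷ s₁) s₂ = b ∷ joinSelections L₁ s₁ s₂

∑-++ : ∀ {a} {A : Set a} (L₁ L₂ : List A) (F : Vec Bool (length (L₁ ++ L₂)) → ℕ) →
       ∑ (length (L₁ ++ L₂)) F ≡ ∑ (length L₁) (λ s₁ → ∑ (length L₂) (λ s₂ → F (joinSelections L₁ s₁ s₂)))
∑-++ []       L₂ F = refl
∑-++ (_ ∷ L₁) L₂ F = cong₂ _+_ (∑-++ L₁ L₂ (F ∘ (true ∷_))) (∑-++ L₁ L₂ (F ∘ (false ∷_)))

mapSelection : ∀ {a b} {A : Set a} {B : Set b} (f : A → B) (L : List A) →
               Vec Bool (length L) → Vec Bool (length (map f L))
mapSelection f []      []      = []
mapSelection f (_ ∷ L) (b ∷ s) = b ∷ mapSelection f L s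

∑-map : ∀ {a b} {A : Set a} {B : Set b} (f : A → B) (L : List A) (F : Vec Bool (length (map f L)) → ℕ) →
        ∑ (length (map f L)) F ≡ ∑ (length L) (F ∘ mapSelection f L)
∑-map f []      F = refl
∑-map f (_ ∷ L) F = cong₂ _+_ (∑-map f L (F ∘ (true ∷_))) (∑-map f L (F ∘ (false ∷_)))

incidence : ∀ {n} → Fin n → Fin n → Fin n → ℕ
incidence a b v = if ⌊ a ≟ v ⌋ ∨ ⌊ b ≟ v ⌋ then 1 else 0

incidence-fst : ∀ {n} (a b : Fin n) → incidence a b a ≡ 1
incidence-fst a b with a ≟ a
... | yes _  = refl
... | no a≢a = ⊥-elim (a≢a refl)

incidence-snd : ∀ {n} (a b : Fin n) → incidence a b b ≡ 1
incidence-snd a b with a ≟ b | b ≟ b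
... | yes _ | _      = refl
... | no _  | yes _  = refl
... | no _  | no b≢b = ⊥-elim (b≢b refl)

incidence-∉ : ∀ {n} {a b v : Fin n} → a ≢ v → b ≢ v → incidence a b v ≡ 0
incidence-∉ {a = a} {b} {v} a≢v b≢v =
  cong₂ (λ p q → if p ∨ q then 1 else 0) (⌊⌋-false (a ≟ v) a≢v) (⌊⌋-false (b ≟ v) b≢v)
  where
  ⌊⌋-false : ∀ {p} {P : Set p} (P? : Dec P) → ¬ P → ⌊ P? ⌋ ≡ false
  ⌊⌋-false P? ¬p = trans (isYes≗does P?) (dec-false P? ¬p)

incidence-injective : ∀ {n n′} {g : Fin n → Fin n′} → Injective _≡_ _≡_ g →
                      ∀ a b u → incidence (g a) (g b) (g u) ≡ incidence a b u
incidence-injective {g = g} g-inj a b u =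
  cong₂ (λ p q → if p ∨ q then 1 else 0) (⌊≟⌋-injective a) (⌊≟⌋-injective b)
  where
  ⌊≟⌋-injective : ∀ a → ⌊ g a ≟ g u ⌋ ≡ ⌊ a ≟ u ⌋
  ⌊≟⌋-injective a = begin
    ⌊ g a ≟ g u ⌋       ≡⟨ isYes≗does (g a ≟ g u) ⟩
    _                   ≡⟨ does-⇔ (mk⇔ g-inj (cong g)) (g a ≟ g u) (a ≟ u) ⟩
    _                   ≡⟨ isYes≗does (a ≟ u) ⟨
    ⌊ a ≟ u ⌋           ∎

degreeIn-++ : ∀ {n} (L₁ L₂ : List (Fin n × Fin n)) s₁ s₂ v →
              degreeIn (L₁ ++ L₂) (joinSelections L₁ s₁ s₂) v ≡ degreeIn L₁ s₁ v + degreeIn L₂ s₂ v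
degreeIn-++ []             L₂ []          s₂ v = refl
degreeIn-++ ((a , b) ∷ L₁) L₂ (true ∷ s₁)  s₂ v =
  trans (cong (incidence a b v +_) (degreeIn-++ L₁ L₂ s₁ s₂ v)) (sym (+-assoc (incidence a b v) _ _))
degreeIn-++ ((a , b) ∷ L₁) L₂ (false ∷ s₁) s₂ v = degreeIn-++ L₁ L₂ s₁ s₂ v

module _ {n n′} {g : Fin n → Fin n′} where

  private
    g² : Fin n × Fin n → Fin n′ × Fin n′
    g² = Product.map g g

  degreeIn-map : Injective _≡_ _≡_ g → ∀ L s u →
                 degreeIn (map g² L) (mapSelection g² L s) (g u) ≡ degreeIn L s u
  degreeIn-map g-inj []            []          u = refl
  degreeIn-map g-inj ((a , b) ∷ L) (true ∷ s)  u =
    cong₂ _+_ (incidence-injective g-inj a b u) (degreeIn-map g-inj L s u)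
  degreeIn-map g-inj ((a , b) ∷ L) (false ∷ s) u = degreeIn-map g-inj L s u

  degreeIn-map-∉ : ∀ {w} → (∀ u → g u ≢ w) → ∀ L s → degreeIn (map g² L) (mapSelection g² L s) w ≡ 0
  degreeIn-map-∉ w∉g []            []          = refl
  degreeIn-map-∉ w∉g ((a , b) ∷ L) (true ∷ s)  =
    cong₂ _+_ (incidence-∉ (w∉g a) (w∉g b)) (degreeIn-map-∉ w∉g L s)
  degreeIn-map-∉ w∉g ((a , b) ∷ L) (false ∷ s) = degreeIn-map-∉ w∉g L s

0̇ 1̇ : ∀ {n} → Fin n → ℕ
0̇ _ = 0
1̇ _ = 1

_≟̇_ : ∀ {n} (f g : Fin n → ℕ) → Dec (f ≗ g)
f ≟̇ g = all? (λ v → f v ≟ℕ g v)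

-- For c = 0̇ this counts the t-factors of the multigraph L.
#factors : ∀ {n} → (Fin n → ℕ) → (L : List (Fin n × Fin n)) → (Fin n → ℕ) → ℕ
#factors c L t = ∑ (length L) (λ s → χ ((λ v → c v + degreeIn L s v) ≟̇ t))

M≡#factors : ∀ G → M G ≡ #factors 0̇ (edges G) 1̇
M≡#factors G = begin
  length (filter (isPerfectMatching? G) (allVecs m))  ≡⟨ length-filter≡sum-χ (isPerfectMatching? G) (allVecs m) ⟩
  sum (map (χ ∘ isPerfectMatching? G) (allVecs m))    ≡⟨ ∑≡sum-allVecs m (χ ∘ isPerfectMatching? G) ⟨
  #factors 0̇ (edges G) 1̇                              ∎
  where m = length (edges G)

#factors-cong : ∀ {n} {c c′ t t′ : Fin n → ℕ} → c ≗ c′ → t ≗ t′ → ∀ L → #factors c L t ≡ #factors c′ L t′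
#factors-cong {c = c} {c′} {t} {t′} c≗c′ t≗t′ L = ∑-cong (λ s → χ-⇔ (deg c s ≟̇ t) (deg c′ s ≟̇ t′)
  (λ eq v → trans (cong (_+ degreeIn L s v) (sym (c≗c′ v))) (trans (eq v) (t≗t′ v)))
  (λ eq v → trans (cong (_+ degreeIn L s v) (c≗c′ v)) (trans (eq v) (sym (t≗t′ v)))))
  where
  deg : (Fin _ → ℕ) → Vec Bool (length L) → Fin _ → ℕ
  deg c s v = c v + degreeIn L s v

#factors-∷ : ∀ {n} (c : Fin n → ℕ) a b L t →
             #factors c ((a , b) ∷ L) t ≡ #factors (λ v → c v + incidence a b v) L t + #factors c L t
#factors-∷ c a b L t = cong (_+ #factors c L t) (∑-cong {F = F} (λ s → χ-⇔ (_ ≟̇ t) (_ ≟̇ t)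
  (λ eq v → trans (+-assoc (c v) (incidence a b v) _) (eq v))
  (λ eq v → trans (sym (+-assoc (c v) (incidence a b v) _)) (eq v))))
  where
  F : Vec Bool (length L) → ℕ
  F s = χ ((λ v → c v + degreeIn ((a , b) ∷ L) (true ∷ s) v) ≟̇ t)

#factors-overfull : ∀ {n} {c t : Fin n → ℕ} L {u} → c u ≢ 0 → t u ≡ 0 → #factors c L t ≡ 0
#factors-overfull {c = c} {t} L {u} cᵤ≢0 tᵤ≡0 =
  ∑-zero (λ s → χ-¬ ((λ v → c v + degreeIn L s v) ≟̇ t) (λ eq → cᵤ≢0 (m+n≡0⇒m≡0 (c u) (trans (eq u) tᵤ≡0))))

-- Deleting vertices

embed : ∀ {n} (D : Vec Bool n) → Fin (countFalse D) → Fin n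
embed (true ∷ D)  w       = suc (embed D w)
embed (false ∷ D) zero    = zero
embed (false ∷ D) (suc w) = suc (embed D w)

embed-injective : ∀ {n} (D : Vec Bool n) → Injective _≡_ _≡_ (embed D)
embed-injective (true ∷ D)  {w}     {w′}     eq = embed-injective D (suc-injective eq)
embed-injective (false ∷ D) {zero}  {zero}   eq = refl
embed-injective (false ∷ D) {suc w} {suc w′} eq = cong suc (embed-injective D (suc-injective eq))

lookup-embed : ∀ {n} (D : Vec Bool n) w → lookup D (embed D w) ≡ false
lookup-embed (true ∷ D)  w       = lookup-embed D w
lookup-embed (false ∷ D) zero    = refl
lookup-embed (false ∷ D) (suc w) = lookup-embed D w

reindex-just : ∀ {n} (D : Vec Bool n) {v w} → reindex D v ≡ just w → embed D w ≡ v
reindex-just (true ∷ D)  {suc v}     eq = cong suc (reindex-just D eq)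
reindex-just (false ∷ D) {zero}  refl  = refl
reindex-just (false ∷ D) {suc v} eq with reindex D v in eq′
reindex-just (false ∷ D) {suc v} refl | just w = cong suc (reindex-just D eq′)

reindex-nothing : ∀ {n} (D : Vec Bool n) {v} → reindex D v ≡ nothing → lookup D v ≡ true
reindex-nothing (true ∷ D)  {zero}  _  = refl
reindex-nothing (true ∷ D)  {suc v} eq = reindex-nothing D eq
reindex-nothing (false ∷ D) {suc v} eq with reindex D v in eq′
... | nothing = reindex-nothing D eq′

kept≢deleted : ∀ {n} (D : Vec Bool n) {u w v} → reindex D u ≡ just w → lookup D v ≡ true → u ≢ v
kept≢deleted D {w = w} eq deleted refl
  with () ← trans (sym (lookup-embed D w)) (trans (cong (lookup D) (reindex-just D eq)) deleted)

incidence-embed : ∀ {n} (D : Vec Bool n) {a b a′ b′} → reindex D a ≡ just a′ → reindex D b ≡ just b′ →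
                  ∀ w → incidence a′ b′ w ≡ incidence a b (embed D w)
incidence-embed D {a} {b} {a′} {b′} ea eb w = begin
  incidence a′ b′ w                                ≡⟨ incidence-injective (embed-injective D) a′ b′ w ⟨
  incidence (embed D a′) (embed D b′) (embed D w)  ≡⟨ cong₂ (λ p q → incidence p q (embed D w)) (reindex-just D ea) (reindex-just D eb) ⟩
  incidence a b (embed D w)                        ∎

oneUnless : Bool → ℕ
oneUnless b = if b then 0 else 1

module _ (G : Graph) (D : Vec Bool (nV G)) where

  private
    n = nV G
    target = oneUnless ∘ lookup D

  -- deleteVertices, evalDel and connectedSum keep their auxiliary maps in where blocks,
  -- which are not exported; keptEdge, removedBy, ι and isCopy recover them by unifying
  -- with the unfolded definitions.
  keptEdge : Fin n × Fin n → Maybe (Fin (countFalse D) × Fin (countFalse D))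
  keptEdge = proj₁ shape
    where
    shape : Σ[ f ∈ (Fin n × Fin n → Maybe (Fin (countFalse D) × Fin (countFalse D))) ]
                edges (deleteVertices G D) ≡ mapMaybe f (edges G)
    shape = _ , refl

  #factors-∷-deleted : ∀ c a b E {u} → lookup D u ≡ true → incidence a b u ≡ 1 →
                       #factors c ((a , b) ∷ E) target ≡ #factors c E target
  #factors-∷-deleted c a b E {u} deleted inc≡1 = begin
    #factors c ((a , b) ∷ E) target                                ≡⟨ #factors-∷ c a b E target ⟩
    #factors (λ v → c v + incidence a b v) E target + #factors c E target
      ≡⟨ cong (_+ #factors c E target) (#factors-overfull E overfull (cong oneUnless deleted)) ⟩
    #factors c E target                                            ∎
    where
    overfull : c u + incidence a b u ≢ 0
    overfull eq with () ← trans (sym inc≡1) (m+n≡0⇒n≡0 (c u) eq)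

  -- The base degree c carries the chosen edges through the induction; it has to vanish
  -- on D because deleted vertices may not be covered.
  #factors-keptEdges : (c : Fin n → ℕ) → (∀ v → lookup D v ≡ true → c v ≡ 0) → ∀ E →
                       #factors (c ∘ embed D) (mapMaybe keptEdge E) 1̇ ≡ #factors c E target
  #factors-keptEdges c c≡0 [] = χ-⇔ _ _ toTarget fromTarget
    where
    toTarget : (∀ w → c (embed D w) + 0 ≡ 1) → ∀ v → c v + 0 ≡ target v
    toTarget h v with reindex D v in eq
    ... | just w  = subst (λ u → c u + 0 ≡ target u) (reindex-just D eq)
                      (trans (h w) (cong oneUnless (sym (lookup-embed D w))))
    ... | nothing = trans (cong (_+ 0) (c≡0 v deleted)) (cong oneUnless (sym deleted))
      where deleted = reindex-nothing D eq
    fromTarget : (∀ v → c v + 0 ≡ target v) → ∀ w → c (embed D w) + 0 ≡ 1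
    fromTarget h w = trans (h (embed D w)) (cong oneUnless (lookup-embed D w))
  #factors-keptEdges c c≡0 ((a , b) ∷ E) with reindex D a in ea | reindex D b in eb
  ... | just a′ | just b′ = begin
    #factors (c ∘ embed D) ((a′ , b′) ∷ E′) 1̇
      ≡⟨ #factors-∷ (c ∘ embed D) a′ b′ E′ 1̇ ⟩
    #factors (λ w → c (embed D w) + incidence a′ b′ w) E′ 1̇ + #factors (c ∘ embed D) E′ 1̇
      ≡⟨ cong (_+ _) (#factors-cong (λ w → cong (c (embed D w) +_) (incidence-embed D ea eb w)) (λ _ → refl) E′) ⟩
    #factors (c′ ∘ embed D) E′ 1̇ + #factors (c ∘ embed D) E′ 1̇
      ≡⟨ cong₂ _+_ (#factors-keptEdges c′ c′≡0 E) (#factors-keptEdges c c≡0 E) ⟩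
    #factors c′ E target + #factors c E target
      ≡⟨ #factors-∷ c a b E target ⟨
    #factors c ((a , b) ∷ E) target ∎
    where
    E′ = mapMaybe keptEdge E
    c′ : Fin n → ℕ
    c′ v = c v + incidence a b v
    c′≡0 : ∀ v → lookup D v ≡ true → c′ v ≡ 0
    c′≡0 v deleted = cong₂ _+_ (c≡0 v deleted) (incidence-∉ (kept≢deleted D ea deleted) (kept≢deleted D eb deleted))
  ... | just a′ | nothing =
    trans (#factors-keptEdges c c≡0 E) (sym (#factors-∷-deleted c a b E (reindex-nothing D eb) (incidence-snd a b)))
  ... | nothing | _       =
    trans (#factors-keptEdges c c≡0 E) (sym (#factors-∷-deleted c a b E (reindex-nothing D ea) (incidence-fst a b)))

M-deleteVertices : ∀ G (f : Fin (nV G) → Bool) →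
                   M (deleteVertices G (tabulate f)) ≡ #factors 0̇ (edges G) (oneUnless ∘ f)
M-deleteVertices G f = begin
  M (deleteVertices G D)                            ≡⟨ M≡#factors (deleteVertices G D) ⟩
  #factors 0̇ (mapMaybe (keptEdge G D) (edges G)) 1̇  ≡⟨ #factors-keptEdges G D 0̇ (λ _ _ → refl) (edges G) ⟩
  #factors 0̇ (edges G) (oneUnless ∘ lookup D)       ≡⟨ #factors-cong (λ _ → refl) (cong oneUnless ∘ lookup∘tabulate f) (edges G) ⟩
  #factors 0̇ (edges G) (oneUnless ∘ f)              ∎
  where D = tabulate f

preimage-just : ∀ {k n} (x : Fin k → Fin n) {v i} → preimage x v ≡ just i → x i ≡ v
preimage-just {suc k} x {v} eq with x zero ≟ v
preimage-just {suc k} x {v} refl | yes x₀≡v = x₀≡v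
... | no _ with preimage (x ∘ suc) v in eq′
preimage-just {suc k} x {v} refl | no _ | just j = preimage-just (x ∘ suc) eq′

preimage-nothing : ∀ {k n} (x : Fin k → Fin n) {v} → preimage x v ≡ nothing → ∀ i → x i ≢ v
preimage-nothing {suc k} x {v} eq i with x zero ≟ v
preimage-nothing {suc k} x {v} () i | yes _
... | no x₀≢v with preimage (x ∘ suc) v in eq′
preimage-nothing {suc k} x {v} refl zero    | no x₀≢v | nothing = x₀≢v
preimage-nothing {suc k} x {v} refl (suc i) | no x₀≢v | nothing = preimage-nothing (x ∘ suc) eq′ i

preimage-injective : ∀ {k n} {x : Fin k → Fin n} → Injective _≡_ _≡_ x → ∀ i → preimage x (x i) ≡ just i
preimage-injective {x = x} x-inj i with preimage x (x i) in eq
... | just j  = cong just (x-inj (preimage-just x eq))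
... | nothing = ⊥-elim (preimage-nothing x eq i refl)

data Preimage {k n} (x : Fin k → Fin n) : Fin n → Set where
  hit  : ∀ i → Preimage x (x i)
  miss : ∀ {v} → preimage x v ≡ nothing → Preimage x v

preimage-view : ∀ {k n} (x : Fin k → Fin n) v → Preimage x v
preimage-view x v with preimage x v in eq
... | just i  = subst (Preimage x) (preimage-just x eq) (hit i)
... | nothing = miss eq

removedBy : (G : Graph) {k : ℕ} → (Fin k → Fin (nV G)) → Vec Bool k → Fin (nV G) → Bool
removedBy G x ε = proj₁ shape
  where
  shape : Σ[ D ∈ (Fin (nV G) → Bool) ] evalDel G x ε ≡ M (deleteVertices G (tabulate D))
  shape = _ , refl

removedBy-hit : ∀ G {k} {x : Fin k → Fin (nV G)} → Injective _≡_ _≡_ x → ∀ ε i → removedBy G x ε (x i) ≡ lookup ε i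
removedBy-hit G x-inj ε i rewrite preimage-injective x-inj i = refl

removedBy-miss : ∀ G {k} {x : Fin k → Fin (nV G)} ε {v} → preimage x v ≡ nothing → removedBy G x ε v ≡ false
removedBy-miss G ε eq rewrite eq = refl

evalDel≡#factors : ∀ G {k} (x : Fin k → Fin (nV G)) ε →
                   evalDel G x ε ≡ #factors 0̇ (edges G) (oneUnless ∘ removedBy G x ε)
evalDel≡#factors G x ε = M-deleteVertices G (removedBy G x ε)

-- Splitting the degrees of a glued selection

+≡1⇒oneUnless : ∀ a b → a + b ≡ 1 → a ≡ oneUnless (a ≡ᵇ 0) × b ≡ oneUnless (not (a ≡ᵇ 0))
+≡1⇒oneUnless 0             b       eq = refl , eq
+≡1⇒oneUnless 1             0       eq = refl , refl
+≡1⇒oneUnless 1             (suc _) ()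
+≡1⇒oneUnless (suc (suc _)) _       ()

oneUnless-+-not : ∀ β → oneUnless β + oneUnless (not β) ≡ 1
oneUnless-+-not true  = refl
oneUnless-+-not false = refl

oneUnless⁻¹ : ∀ {a} β → a ≡ oneUnless β → β ≡ (a ≡ᵇ 0)
oneUnless⁻¹ true  refl = refl
oneUnless⁻¹ false refl = refl

module Splitting (G₁ G₂ : Graph) {k : ℕ} {x : Fin k → Fin (nV G₁)} {y : Fin k → Fin (nV G₂)}
                 (x-inj : Injective _≡_ _≡_ x) (y-inj : Injective _≡_ _≡_ y) where

  target₁ : Vec Bool k → Fin (nV G₁) → ℕ
  target₁ ε = oneUnless ∘ removedBy G₁ x ε

  target₂ : Vec Bool k → Fin (nV G₂) → ℕ
  target₂ ε = oneUnless ∘ removedBy G₂ y (Vec.map not ε)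

  -- The degrees of a perfect matching of G₁ # G₂, split into its G₁- and G₂-edges.
  record PerfectAcross (d₁ : Fin (nV G₁) → ℕ) (d₂ : Fin (nV G₂) → ℕ) : Set where
    field
      free₁ : ∀ {u} → preimage x u ≡ nothing → d₁ u ≡ 1
      free₂ : ∀ {v} → preimage y v ≡ nothing → d₂ v ≡ 1
      glued : ∀ i → d₁ (x i) + d₂ (y i) ≡ 1

  choice : (Fin (nV G₁) → ℕ) → Vec Bool k
  choice d₁ = tabulate (λ i → d₁ (x i) ≡ᵇ 0)

  private
    target₁-hit : ∀ ε i → target₁ ε (x i) ≡ oneUnless (lookup ε i)
    target₁-hit ε i = cong oneUnless (removedBy-hit G₁ x-inj ε i)

    target₂-hit : ∀ ε i → target₂ ε (y i) ≡ oneUnless (not (lookup ε i))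
    target₂-hit ε i = cong oneUnless (trans (removedBy-hit G₂ y-inj (Vec.map not ε) i) (lookup-map i not ε))

    target₁-miss : ∀ ε {u} → preimage x u ≡ nothing → target₁ ε u ≡ 1
    target₁-miss ε eq = cong oneUnless (removedBy-miss G₁ ε eq)

    target₂-miss : ∀ ε {v} → preimage y v ≡ nothing → target₂ ε v ≡ 1
    target₂-miss ε eq = cong oneUnless (removedBy-miss G₂ (Vec.map not ε) eq)

  module _ {d₁ : Fin (nV G₁) → ℕ} {d₂ : Fin (nV G₂) → ℕ} where

    across⇒split : PerfectAcross d₁ d₂ → d₁ ≗ target₁ (choice d₁) × d₂ ≗ target₂ (choice d₁)
    across⇒split p = (λ u → on₁ (preimage-view x u)) , (λ v → on₂ (preimage-view y v))
      where
      open PerfectAcross p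
      ε₀ = choice d₁
      lookup-ε₀ : ∀ i → lookup ε₀ i ≡ (d₁ (x i) ≡ᵇ 0)
      lookup-ε₀ = lookup∘tabulate (λ i → d₁ (x i) ≡ᵇ 0)
      on₁ : ∀ {u} → Preimage x u → d₁ u ≡ target₁ ε₀ u
      on₁ (hit i) = begin
        d₁ (x i)                     ≡⟨ proj₁ (+≡1⇒oneUnless _ _ (glued i)) ⟩
        oneUnless (d₁ (x i) ≡ᵇ 0)    ≡⟨ cong oneUnless (lookup-ε₀ i) ⟨
        oneUnless (lookup ε₀ i)      ≡⟨ target₁-hit ε₀ i ⟨
        target₁ ε₀ (x i)             ∎
      on₁ (miss eq) = trans (free₁ eq) (sym (target₁-miss ε₀ eq))
      on₂ : ∀ {v} → Preimage y v → d₂ v ≡ target₂ ε₀ v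
      on₂ (hit i) = begin
        d₂ (y i)                           ≡⟨ proj₂ (+≡1⇒oneUnless _ _ (glued i)) ⟩
        oneUnless (not (d₁ (x i) ≡ᵇ 0))    ≡⟨ cong (oneUnless ∘ not) (lookup-ε₀ i) ⟨
        oneUnless (not (lookup ε₀ i))      ≡⟨ target₂-hit ε₀ i ⟨
        target₂ ε₀ (y i)                   ∎
      on₂ (miss eq) = trans (free₂ eq) (sym (target₂-miss ε₀ eq))

    split⇒across : ∀ {ε} → d₁ ≗ target₁ ε → d₂ ≗ target₂ ε → PerfectAcross d₁ d₂
    split⇒across {ε} h₁ h₂ = record
      { free₁ = λ {u} eq → trans (h₁ u) (target₁-miss ε eq)
      ; free₂ = λ {v} eq → trans (h₂ v) (target₂-miss ε eq)
      ; glued = λ i → trans (cong₂ _+_ (trans (h₁ (x i)) (target₁-hit ε i)) (trans (h₂ (y i)) (target₂-hit ε i)))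
                            (oneUnless-+-not (lookup ε i))
      }

    split-unique : ∀ {ε} → d₁ ≗ target₁ ε → ε ≡ choice d₁
    split-unique {ε} h₁ = trans (sym (tabulate∘lookup ε))
      (tabulate-cong (λ i → oneUnless⁻¹ (lookup ε i) (trans (h₁ (x i)) (target₁-hit ε i))))

    χ-split : ∀ {p} {P : Set p} (P? : Dec P) → (P → PerfectAcross d₁ d₂) → (PerfectAcross d₁ d₂ → P) →
              χ P? ≡ ∑ k (λ ε → χ (d₁ ≟̇ target₁ ε) * χ (d₂ ≟̇ target₂ ε))
    χ-split P? to from = begin
      χ P?
        ≡⟨ χ-⇔ P? (split? ε₀) (across⇒split ∘ to) (λ (h₁ , h₂) → from (split⇒across h₁ h₂)) ⟩
      χ (split? ε₀)
        ≡⟨ χ-× (d₁ ≟̇ target₁ ε₀) (d₂ ≟̇ target₂ ε₀) ⟩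
      χ (d₁ ≟̇ target₁ ε₀) * χ (d₂ ≟̇ target₂ ε₀)
        ≡⟨ ∑-single ε₀ (λ ε ε≢ε₀ → cong (_* χ (d₂ ≟̇ target₂ ε)) (χ-¬ (d₁ ≟̇ target₁ ε) (ε≢ε₀ ∘ split-unique))) ⟨
      ∑ k (λ ε → χ (d₁ ≟̇ target₁ ε) * χ (d₂ ≟̇ target₂ ε)) ∎
      where
      ε₀ = choice d₁
      split? : ∀ ε → Dec (d₁ ≗ target₁ ε × d₂ ≗ target₂ ε)
      split? ε = (d₁ ≟̇ target₁ ε) ×-dec (d₂ ≟̇ target₂ ε)

-- The connected sum

module Gluing (G₁ G₂ : Graph) {k : ℕ} (x : Fin k → Fin (nV G₁)) (y : Fin k → Fin (nV G₂))
              (x-inj : Injective _≡_ _≡_ x) (y-inj : Injective _≡_ _≡_ y) where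

  open Splitting G₁ G₂ x-inj y-inj using (PerfectAcross)

  private
    n₁ = nV G₁
    n₂ = nV G₂
    E₁ = edges G₁
    E₂ = edges G₂

    inl² : Fin n₁ × Fin n₁ → Fin (n₁ + n₂) × Fin (n₁ + n₂)
    inl² = Product.map (_↑ˡ n₂) (_↑ˡ n₂)

    union : (Fin n₂ → Fin (n₁ + n₂)) → Graph
    union ι = graph (n₁ + n₂) (map inl² E₁ ++ map (Product.map ι ι) E₂)

    shape : Σ[ ι ∈ (Fin n₂ → Fin (n₁ + n₂)) ] Σ[ isCopy ∈ (Fin (n₁ + n₂) → Bool) ]
            connectedSum G₁ G₂ x y ≡ deleteVertices (union ι) (tabulate isCopy)
    shape = _ , _ , refl

  ι : Fin n₂ → Fin (n₁ + n₂)
  ι = proj₁ shape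

  isCopy : Fin (n₁ + n₂) → Bool
  isCopy = proj₁ (proj₂ shape)

  private
    ι² : Fin n₂ × Fin n₂ → Fin (n₁ + n₂) × Fin (n₁ + n₂)
    ι² = Product.map ι ι

  ι-hit : ∀ i → ι (y i) ≡ x i ↑ˡ n₂
  ι-hit i rewrite preimage-injective y-inj i = refl

  ι-miss : ∀ {v} → preimage y v ≡ nothing → ι v ≡ n₁ ↑ʳ v
  ι-miss eq rewrite eq = refl

  isCopy-↑ˡ : ∀ u → isCopy (u ↑ˡ n₂) ≡ false
  isCopy-↑ˡ u rewrite splitAt-↑ˡ n₁ u n₂ = refl

  isCopy-↑ʳ : ∀ v → isCopy (n₁ ↑ʳ v) ≡ is-just (preimage y v)
  isCopy-↑ʳ v rewrite splitAt-↑ʳ n₁ n₂ v = refl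

  ↑ˡ≢↑ʳ : ∀ {u v} → u ↑ˡ n₂ ≢ n₁ ↑ʳ v
  ↑ˡ≢↑ʳ {u} {v} eq with () ← trans (sym (splitAt-↑ˡ n₁ u n₂)) (trans (cong (splitAt n₁) eq) (splitAt-↑ʳ n₁ n₂ v))

  ι-injective : Injective _≡_ _≡_ ι
  ι-injective {v} {v′} = go (preimage-view y v) (preimage-view y v′)
    where
    go : ∀ {v v′} → Preimage y v → Preimage y v′ → ι v ≡ ι v′ → v ≡ v′
    go (hit i)  (hit j)   eq = cong y (x-inj (↑ˡ-injective n₂ _ _ (trans (sym (ι-hit i)) (trans eq (ι-hit j)))))
    go (hit i)  (miss e′) eq = ⊥-elim (↑ˡ≢↑ʳ (trans (sym (ι-hit i)) (trans eq (ι-miss e′))))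
    go (miss e) (hit j)   eq = ⊥-elim (↑ˡ≢↑ʳ (trans (sym (ι-hit j)) (trans (sym eq) (ι-miss e))))
    go (miss e) (miss e′) eq = ↑ʳ-injective n₁ _ _ (trans (sym (ι-miss e)) (trans eq (ι-miss e′)))

  ι-avoids-only₁ : ∀ {u} → preimage x u ≡ nothing → ∀ v → ι v ≢ u ↑ˡ n₂
  ι-avoids-only₁ {u} eq v = go (preimage-view y v)
    where
    go : ∀ {v} → Preimage y v → ι v ≢ u ↑ˡ n₂
    go (hit j)   ιv≡u = preimage-nothing x eq j (↑ˡ-injective n₂ _ _ (trans (sym (ι-hit j)) ιv≡u))
    go (miss e′) ιv≡u = ↑ˡ≢↑ʳ (trans (sym ιv≡u) (ι-miss e′))

  ι-avoids-copy : ∀ i v → ι v ≢ n₁ ↑ʳ y i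
  ι-avoids-copy i v = go (preimage-view y v)
    where
    go : ∀ {v} → Preimage y v → ι v ≢ n₁ ↑ʳ y i
    go (hit j)   ιv≡yᵢ = ↑ˡ≢↑ʳ (trans (sym (ι-hit j)) ιv≡yᵢ)
    go (miss e′) ιv≡yᵢ = preimage-nothing y e′ i (sym (↑ʳ-injective n₁ _ _ (trans (sym (ι-miss e′)) ιv≡yᵢ)))

  data Vertex : Fin (n₁ + n₂) → Set where
    only₁  : ∀ {u} → preimage x u ≡ nothing → Vertex (u ↑ˡ n₂)
    shared : ∀ i → Vertex (x i ↑ˡ n₂)
    only₂  : ∀ {v} → preimage y v ≡ nothing → Vertex (n₁ ↑ʳ v)
    copy   : ∀ i → Vertex (n₁ ↑ʳ y i)

  vertex : ∀ w → Vertex w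
  vertex w with splitAt n₁ w in eq
  ... | inj₁ u = subst Vertex (splitAt⁻¹-↑ˡ eq) (left (preimage-view x u))
    where
    left : ∀ {u} → Preimage x u → Vertex (u ↑ˡ n₂)
    left (hit i)   = shared i
    left (miss eq) = only₁ eq
  ... | inj₂ v = subst Vertex (splitAt⁻¹-↑ʳ eq) (right (preimage-view y v))
    where
    right : ∀ {v} → Preimage y v → Vertex (n₁ ↑ʳ v)
    right (hit i)   = copy i
    right (miss eq) = only₂ eq

  D₁ : Selection G₁ → Fin (n₁ + n₂) → ℕ
  D₁ s₁ = degreeIn (map inl² E₁) (mapSelection inl² E₁ s₁)

  D₂ : Selection G₂ → Fin (n₁ + n₂) → ℕ
  D₂ s₂ = degreeIn (map ι² E₂) (mapSelection ι² E₂ s₂)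

  target : Fin (n₁ + n₂) → ℕ
  target = oneUnless ∘ isCopy

  M-connectedSum : M (connectedSum G₁ G₂ x y) ≡
                   ∑ (length E₁) (λ s₁ → ∑ (length E₂) (λ s₂ → χ ((λ w → D₁ s₁ w + D₂ s₂ w) ≟̇ target)))
  M-connectedSum = begin
    M (connectedSum G₁ G₂ x y)
      ≡⟨ M-deleteVertices (union ι) isCopy ⟩
    ∑ (length (L₁ ++ L₂)) perfect
      ≡⟨ ∑-++ L₁ L₂ perfect ⟩
    ∑ (length L₁) (λ s₁ → ∑ (length L₂) (λ s₂ → perfect (joinSelections L₁ s₁ s₂)))
      ≡⟨ ∑-map inl² E₁ (λ s₁ → ∑ (length L₂) (λ s₂ → perfect (joinSelections L₁ s₁ s₂))) ⟩
    ∑ (length E₁) (λ s₁ → ∑ (length L₂) (λ s₂ → perfect (joinSelections L₁ (mapSelection inl² E₁ s₁) s₂)))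
      ≡⟨ ∑-cong (λ s₁ → ∑-map ι² E₂ (λ s₂ → perfect (joinSelections L₁ (mapSelection inl² E₁ s₁) s₂))) ⟩
    ∑ (length E₁) (λ s₁ → ∑ (length E₂) (λ s₂ → perfect (joined s₁ s₂)))
      ≡⟨ ∑-cong (λ s₁ → ∑-cong (λ s₂ → χ-⇔ (degreeIn (L₁ ++ L₂) (joined s₁ s₂) ≟̇ target) (_ ≟̇ target)
           (λ eq w → trans (sym (degreeIn-++ L₁ L₂ _ _ w)) (eq w))
           (λ eq w → trans (degreeIn-++ L₁ L₂ _ _ w) (eq w)))) ⟩
    ∑ (length E₁) (λ s₁ → ∑ (length E₂) (λ s₂ → χ ((λ w → D₁ s₁ w + D₂ s₂ w) ≟̇ target))) ∎
    where
    L₁ = map inl² E₁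
    L₂ = map ι² E₂
    perfect : Vec Bool (length (L₁ ++ L₂)) → ℕ
    perfect s = χ (degreeIn (L₁ ++ L₂) s ≟̇ target)
    joined : Selection G₁ → Selection G₂ → Vec Bool (length (L₁ ++ L₂))
    joined s₁ s₂ = joinSelections L₁ (mapSelection inl² E₁ s₁) (mapSelection ι² E₂ s₂)

  target-↑ˡ : ∀ u → target (u ↑ˡ n₂) ≡ 1
  target-↑ˡ u = cong oneUnless (isCopy-↑ˡ u)

  target-only₂ : ∀ {v} → preimage y v ≡ nothing → target (n₁ ↑ʳ v) ≡ 1
  target-only₂ {v} eq = cong oneUnless (trans (isCopy-↑ʳ v) (cong is-just eq))

  target-copy : ∀ i → target (n₁ ↑ʳ y i) ≡ 0
  target-copy i = cong oneUnless (trans (isCopy-↑ʳ (y i)) (cong is-just (preimage-injective y-inj i)))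

  module _ (s₁ : Selection G₁) (s₂ : Selection G₂) where

    private
      d₁ = degreeIn E₁ s₁
      d₂ = degreeIn E₂ s₂

      D₁-↑ˡ : ∀ u → D₁ s₁ (u ↑ˡ n₂) ≡ d₁ u
      D₁-↑ˡ = degreeIn-map (↑ˡ-injective n₂ _ _) E₁ s₁

      D₁-↑ʳ : ∀ v → D₁ s₁ (n₁ ↑ʳ v) ≡ 0
      D₁-↑ʳ v = degreeIn-map-∉ (λ u → ↑ˡ≢↑ʳ) E₁ s₁

      D₂-ι : ∀ v → D₂ s₂ (ι v) ≡ d₂ v
      D₂-ι = degreeIn-map ι-injective E₂ s₂

      D₂-∉ : ∀ {w} → (∀ v → ι v ≢ w) → D₂ s₂ w ≡ 0
      D₂-∉ w∉ι = degreeIn-map-∉ w∉ι E₂ s₂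

    degree-only₁ : ∀ {u} → preimage x u ≡ nothing → D₁ s₁ (u ↑ˡ n₂) + D₂ s₂ (u ↑ˡ n₂) ≡ d₁ u
    degree-only₁ {u} eq = trans (cong₂ _+_ (D₁-↑ˡ u) (D₂-∉ (ι-avoids-only₁ eq))) (+-identityʳ (d₁ u))

    degree-shared : ∀ i → D₁ s₁ (x i ↑ˡ n₂) + D₂ s₂ (x i ↑ˡ n₂) ≡ d₁ (x i) + d₂ (y i)
    degree-shared i = cong₂ _+_ (D₁-↑ˡ (x i)) (trans (cong (D₂ s₂) (sym (ι-hit i))) (D₂-ι (y i)))

    degree-only₂ : ∀ {v} → preimage y v ≡ nothing → D₁ s₁ (n₁ ↑ʳ v) + D₂ s₂ (n₁ ↑ʳ v) ≡ d₂ v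
    degree-only₂ {v} eq = cong₂ _+_ (D₁-↑ʳ v) (trans (cong (D₂ s₂) (sym (ι-miss eq))) (D₂-ι v))

    degree-copy : ∀ i → D₁ s₁ (n₁ ↑ʳ y i) + D₂ s₂ (n₁ ↑ʳ y i) ≡ 0
    degree-copy i = cong₂ _+_ (D₁-↑ʳ (y i)) (D₂-∉ (ι-avoids-copy i))

    perfect⇒across : (λ w → D₁ s₁ w + D₂ s₂ w) ≗ target → PerfectAcross d₁ d₂
    perfect⇒across h = record
      { free₁ = λ {u} eq → trans (sym (degree-only₁ eq)) (trans (h _) (target-↑ˡ u))
      ; free₂ = λ eq → trans (sym (degree-only₂ eq)) (trans (h _) (target-only₂ eq))
      ; glued = λ i → trans (sym (degree-shared i)) (trans (h _) (target-↑ˡ (x i)))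
      }

    across⇒perfect : PerfectAcross d₁ d₂ → (λ w → D₁ s₁ w + D₂ s₂ w) ≗ target
    across⇒perfect p w = at (vertex w)
      where
      open PerfectAcross p
      at : ∀ {w} → Vertex w → D₁ s₁ w + D₂ s₂ w ≡ target w
      at (only₁ {u} eq) = trans (degree-only₁ eq) (trans (free₁ eq) (sym (target-↑ˡ u)))
      at (shared i)     = trans (degree-shared i) (trans (glued i) (sym (target-↑ˡ (x i))))
      at (only₂ eq)     = trans (degree-only₂ eq) (trans (free₂ eq) (sym (target-only₂ eq)))
      at (copy i)       = trans (degree-copy i) (sym (target-copy i))

theorem1p1 : (G₁ G₂ : Graph) (k : ℕ)
    (x : Fin k → Fin (nV G₁)) (y : Fin k → Fin (nV G₂)) →
    Injective _≡_ _≡_ x → Injective _≡_ _≡_ y →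
    M (connectedSum G₁ G₂ x y)
      ≡ sum (map (λ ε → evalDel G₁ x ε * evalDel G₂ y (Vec.map not ε)) (allVecs k))
theorem1p1 G₁ G₂ k x y x-inj y-inj = begin
  M (connectedSum G₁ G₂ x y)
    ≡⟨ M-connectedSum ⟩
  ∑ m₁ (λ s₁ → ∑ m₂ (λ s₂ → χ ((λ w → D₁ s₁ w + D₂ s₂ w) ≟̇ target)))
    ≡⟨ ∑-cong (λ s₁ → ∑-cong (λ s₂ → χ-split (_ ≟̇ target) (perfect⇒across s₁ s₂) (across⇒perfect s₁ s₂))) ⟩
  ∑ m₁ (λ s₁ → ∑ m₂ (λ s₂ → ∑ k (λ ε → F₁ ε s₁ * F₂ ε s₂)))
    ≡⟨ ∑-cong (λ s₁ → ∑-comm (λ s₂ ε → F₁ ε s₁ * F₂ ε s₂)) ⟩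
  ∑ m₁ (λ s₁ → ∑ k (λ ε → ∑ m₂ (λ s₂ → F₁ ε s₁ * F₂ ε s₂)))
    ≡⟨ ∑-comm (λ s₁ ε → ∑ m₂ (λ s₂ → F₁ ε s₁ * F₂ ε s₂)) ⟩
  ∑ k (λ ε → ∑ m₁ (λ s₁ → ∑ m₂ (λ s₂ → F₁ ε s₁ * F₂ ε s₂)))
    ≡⟨ ∑-cong (λ ε → ∑*∑ (F₁ ε) (F₂ ε)) ⟨
  ∑ k (λ ε → ∑ m₁ (F₁ ε) * ∑ m₂ (F₂ ε))
    ≡⟨ ∑-cong (λ ε → cong₂ _*_ (evalDel≡#factors G₁ x ε) (evalDel≡#factors G₂ y (Vec.map not ε))) ⟨
  ∑ k (λ ε → evalDel G₁ x ε * evalDel G₂ y (Vec.map not ε))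
    ≡⟨ ∑≡sum-allVecs k _ ⟩
  sum (map (λ ε → evalDel G₁ x ε * evalDel G₂ y (Vec.map not ε)) (allVecs k)) ∎
  where
  open Splitting G₁ G₂ x-inj y-inj
  open Gluing G₁ G₂ x y x-inj y-inj
  m₁ = length (edges G₁)
  m₂ = length (edges G₂)
  F₁ : Vec Bool k → Selection G₁ → ℕ
  F₁ ε s₁ = χ (degreeIn (edges G₁) s₁ ≟̇ target₁ ε)
  F₂ : Vec Bool k → Selection G₂ → ℕ
  F₂ ε s₂ = χ (degreeIn (edges G₂) s₂ ≟̇ target₂ ε)
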